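{- Let $G^g,H^h$ be games with activeness such that $G^g$ is covered by $H^h$. Then $G^g=H^h$ if and only if both of the following hold: (b1) $\mathrm{type}(G^g)=\mathrm{type}(H^h)$; (b2) for every option $H'^{h'}$ of $H^h$ that is uncovered by $G^g$, there exists an option $H''^{h''}\in H'^{h'}$ with $H''^{h''}=G^g$.
   Context: Let $\mathcal{B}=\{0,1\}$. Define $\mathbb{I}_0=\{\emptyset\}\times\mathcal{B}$ and $\mathbb{I}_n=2^{\mathbb{I}_{n-1}}\times\mathcal{B}$ for $n\ge1$; a game with activeness is an element of $\mathbb{I}=\bigcup_{n\ge0}\mathbb{I}_n$. A pair $(G,g)$ is written $G^g$; the elements of $G$ are the options of $G^g$, and $g=1$ means active, $g=0$ inactive. The outcome $o$ is defined recursively: $o(G^g)=\mathscr{N}$ if $g=1$ and some option has outcome $\mathscr{P}$, and $o(G^g)=\mathscr{P}$ otherwise. The sum is $G^g+H^h=(\{G'^{g'}+H^h:G'^{g'}\in G^g\}\cup\{G^g+H'^{h'}:H'^{h'}\in H^h\})^{\max\{g,h\}}$. $G^g=H^h$ means $o(G^g+X^x)=o(H^h+X^x)$ for all games $X^x$. An option $G'^{g'}$ of $G^g$ is uncovered by $H^h$ if $G'^{g'}\neq H'^{h'}$ for all options $H'^{h'}$ of $H^h$; $G^g$ is covered by $H^h$ if $G^g$ has no option uncovered by $H^h$. $\mathrm{type}(G^g)$ is $0$ if $g=0$; $1_{\exists0}$ if $g=1$ and some option $G'^{g'}$ has $g'=0$; $1_{\forall1}$ if $g=1$ and every option $G'^{g'}$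 has $g'=1$. -}

module Defs where

open import Data.Bool using (Bool; true; false; _∨_; _∧_; not)
open import Data.List using (List; []; _∷_; _++_)
open import Data.List.Membership.Propositional using (_∈_)
open import Data.Product using (Σ; _×_; ∃-syntax)
open import Relation.Binary.PropositionalEquality using (_≡_)
open import Relation.Nullary using (¬_)

-- A game with activeness G^g: a finite collection of options (a list; order
-- and multiplicity are irrelevant for all notions below) and an activeness bit.
data Game : Set where
  mk : List Game → Bool → Game

options : Game → List Game
options (mk Gs _) = Gs

active : Game → Bool
active (mk _ g) = g

data Outcome : Set where
  𝒩 𝒫 : Outcome

mutual
  outcome : Game → Outcome
  outcome (mk Gs false) = 𝒫
  outcome (mk Gs true) with someP Gs
  ... | true  = 𝒩
  ... | false = 𝒫

  someP : List Game → Bool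
  someP [] = false
  someP (G ∷ Gs) = isP (outcome G) ∨ someP Gs

  isP : Outcome → Bool
  isP 𝒩 = false
  isP 𝒫 = true

mutual
  infixl 6 _⊕_
  _⊕_ : Game → Game → Game
  mk Gs g ⊕ mk Hs h = mk (addL Gs (mk Hs h) ++ addR (mk Gs g) Hs) (g ∨ h)

  addL : List Game → Game → List Game
  addL [] H = []
  addL (G′ ∷ Gs) H = (G′ ⊕ H) ∷ addL Gs H

  addR : Game → List Game → List Game
  addR G [] = []
  addR G (H′ ∷ Hs) = (G ⊕ H′) ∷ addR G Hs

infix 4 _≈_
_≈_ : Game → Game → Set
G ≈ H = ∀ X → outcome (G ⊕ X) ≡ outcome (H ⊕ X)

UncoveredBy : Game → Game → Set
UncoveredBy G′ H = ∀ H′ → H′ ∈ options H → ¬ (G′ ≈ H′)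

CoveredBy : Game → Game → Set
CoveredBy G H = ¬ (Σ Game λ G′ → G′ ∈ options G × UncoveredBy G′ H)

data GType : Set where
  t0 t1∃0 t1∀1 : GType

someInactive : List Game → Bool
someInactive [] = false
someInactive (G ∷ Gs) = not (active G) ∨ someInactive Gs

type : Game → GType
type (mk Gs false) = t0
type (mk Gs true) with someInactive Gs
... | true  = t1∃0
... | false = t1∀1

-- Two games are equal iff they have the same type and every option of each is
-- matched in the other: it equals an option of the other game or has an
-- option equal to the other game. Sufficiency is an induction on the context.
-- For necessity, any context telling A and B apart can be turned into an
-- active T with A ⊕ T in 𝒫 and B ⊕ T in 𝒩 (every move of A is answered by
-- mirroring). If an option B′ of B is unmatched in A, merging these
-- separators for all options of A and of B′ gives an active T with A ⊕ T and
-- B′ ⊕ T both in 𝒫, so B ⊕ T is in 𝒩. The same facts decide equality by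
-- recursion on height, with a distinguishing context as evidence of
-- inequality, which makes the classical hypotheses usable constructively.
-- Under the covering hypothesis the options of G are matched automatically,
-- and matchedness of the options of H is exactly (b2).
module Submission where

open import Defs
open import Level using (Level)
open import Data.Bool using (true; false; _∨_)
open import Data.Bool.Properties using (∨-zeroʳ; ∨-identityʳ)
open import Data.Empty using (⊥-elim)
open import Data.List using (List; []; _∷_; _++_; map)
open import Data.List.Membership.Propositional using (_∈_; mapWith∈)
open import Data.List.Membership.Propositional.Properties
  using (∈-map⁺; ∈-map⁻; ∈-++⁺ˡ; ∈-++⁺ʳ; ∈-++⁻)
open import Data.List.Relation.Unary.Any using (here; there)
open import Data.Nat using (ℕ; suc; _+_; _⊔_; _≤_; _<_; s≤s)
open import Data.Nat.Properties
  using (≤-refl; ≤-trans; <-trans; <-≤-trans; m≤m⊔n; m≤n⊔m; +-mono-<; +-monoˡ-<; +-monoʳ-<)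
open import Data.Product using (Σ; _×_; _,_)
open import Data.Sum as Sum using (_⊎_; inj₁; inj₂)
open import Function.Bundles using (_⇔_; mk⇔)
open import Relation.Binary.PropositionalEquality
  using (_≡_; _≢_; refl; sym; trans; cong; subst)
open import Relation.Nullary using (¬_)

private
  variable
    a b p q : Level
    X : Set a
    Y : Set b

∈-mapWith∈⁺ : ∀ {xs : List X} (f : ∀ {x} → x ∈ xs → Y) {x} (x∈xs : x ∈ xs) →
              f x∈xs ∈ mapWith∈ xs f
∈-mapWith∈⁺ f (here refl) = here refl
∈-mapWith∈⁺ f (there x∈xs) = there (∈-mapWith∈⁺ (λ x∈ → f (there x∈)) x∈xs)

∈-mapWith∈⁻ : ∀ (xs : List X) (f : ∀ {x} → x ∈ xs → Y) {y} → y ∈ mapWith∈ xs f →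
              Σ X λ x → Σ (x ∈ xs) λ x∈xs → y ≡ f x∈xs
∈-mapWith∈⁻ (x ∷ xs) f (here y≡) = x , here refl , y≡
∈-mapWith∈⁻ (x ∷ xs) f (there y∈) with ∈-mapWith∈⁻ xs (λ x∈ → f (there x∈)) y∈
... | x′ , x′∈xs , y≡ = x′ , there x′∈xs , y≡

∈-any-or-all : ∀ {P : X → Set p} {Q : X → Set q} (xs : List X) →
               (∀ x → x ∈ xs → P x ⊎ Q x) →
               (Σ X λ x → x ∈ xs × P x) ⊎ (∀ x → x ∈ xs → Q x)
∈-any-or-all [] _ = inj₂ λ _ ()
∈-any-or-all (y ∷ xs) P⊎Q with P⊎Q y (here refl) | ∈-any-or-all xs (λ x x∈ → P⊎Q x (there x∈))
... | inj₁ Py | _                 = inj₁ (y , here refl , Py)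
... | inj₂ _  | inj₁ (x , x∈ , Px) = inj₁ (x , there x∈ , Px)
... | inj₂ Qy | inj₂ allQ          = inj₂ λ where
  _ (here refl) → Qy
  x (there x∈)  → allQ x x∈

module _ (P : Game → Set p) (step : ∀ G → (∀ G′ → G′ ∈ options G → P G′) → P G) where
  mutual
    game-ind : ∀ G → P G
    game-ind (mk Gs g) = step (mk Gs g) (games-ind Gs)

    games-ind : ∀ Gs G′ → G′ ∈ Gs → P G′
    games-ind (G ∷ Gs) G′ (here refl) = game-ind G
    games-ind (G ∷ Gs) G′ (there G′∈) = games-ind Gs G′ G′∈

mutual
  height : Game → ℕ
  height (mk Gs _) = suc (heights Gs)

  heights : List Game → ℕ
  heights []       = 0
  heights (G ∷ Gs) = height G ⊔ heights Gs

height≤heights : ∀ {G Gs} → G ∈ Gs → height G ≤ heights Gs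
height≤heights {G} {_ ∷ Gs} (here refl) = m≤m⊔n (height G) (heights Gs)
height≤heights {G} {G₀ ∷ Gs} (there G∈) =
  ≤-trans (height≤heights G∈) (m≤n⊔m (height G₀) (heights Gs))

height-option< : ∀ G {G′} → G′ ∈ options G → height G′ < height G
height-option< (mk Gs _) G′∈ = s≤s (height≤heights G′∈)

true≢false : true ≢ false
true≢false ()

𝒩≢𝒫 : 𝒩 ≢ 𝒫
𝒩≢𝒫 ()

≢𝒫⇒≡𝒩 : ∀ {o} → o ≢ 𝒫 → o ≡ 𝒩
≢𝒫⇒≡𝒩 {𝒩} _   = refl
≢𝒫⇒≡𝒩 {𝒫} o≢𝒫 = ⊥-elim (o≢𝒫 refl)

≡-by-𝒫 : ∀ {o₁ o₂} → (o₁ ≡ 𝒫 → o₂ ≡ 𝒫) → (o₂ ≡ 𝒫 → o₁ ≡ 𝒫) → o₁ ≡ o₂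
≡-by-𝒫 {𝒩} {𝒩} _ _ = refl
≡-by-𝒫 {𝒫} {𝒫} _ _ = refl
≡-by-𝒫 {𝒩} {𝒫} _ ⇐ = ⇐ refl
≡-by-𝒫 {𝒫} {𝒩} ⇒ _ = sym (⇒ refl)

someP-true : ∀ {G Gs} → G ∈ Gs → outcome G ≡ 𝒫 → someP Gs ≡ true
someP-true (here refl) G-𝒫 rewrite G-𝒫 = refl
someP-true {Gs = G₀ ∷ _} (there G∈) G-𝒫 rewrite someP-true G∈ G-𝒫 = ∨-zeroʳ (isP (outcome G₀))

someP-false : ∀ Gs → (∀ G → G ∈ Gs → outcome G ≡ 𝒩) → someP Gs ≡ false
someP-false []       _    = refl
someP-false (G ∷ Gs) all𝒩 rewrite all𝒩 G (here refl) =
  someP-false Gs (λ G′ G′∈ → all𝒩 G′ (there G′∈))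

𝒫-intro : ∀ G → (active G ≡ true → ∀ G′ → G′ ∈ options G → outcome G′ ≡ 𝒩) → outcome G ≡ 𝒫
𝒫-intro (mk Gs false) _    = refl
𝒫-intro (mk Gs true)  all𝒩 rewrite someP-false Gs (all𝒩 refl) = refl

𝒩-intro : ∀ G {G′} → active G ≡ true → G′ ∈ options G → outcome G′ ≡ 𝒫 → outcome G ≡ 𝒩
𝒩-intro (mk Gs true) refl G′∈ G′-𝒫 rewrite someP-true G′∈ G′-𝒫 = refl

𝒫-elim : ∀ G {G′} → outcome G ≡ 𝒫 → active G ≡ true → G′ ∈ options G → outcome G′ ≡ 𝒩
𝒫-elim G G-𝒫 act G′∈ = ≢𝒫⇒≡𝒩 λ G′-𝒫 → 𝒩≢𝒫 (trans (sym (𝒩-intro G act G′∈ G′-𝒫)) G-𝒫)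

𝒩⇒active : ∀ G → outcome G ≡ 𝒩 → active G ≡ true
𝒩⇒active (mk _ true)  _  = refl
𝒩⇒active (mk _ false) ()

inactive⇒𝒫 : ∀ G → active G ≡ false → outcome G ≡ 𝒫
inactive⇒𝒫 (mk _ false) refl = refl

active-⊕ : ∀ A B → active (A ⊕ B) ≡ active A ∨ active B
active-⊕ (mk _ _) (mk _ _) = refl

active-⊕ˡ : ∀ A B → active A ≡ true → active (A ⊕ B) ≡ true
active-⊕ˡ A B A-active rewrite active-⊕ A B | A-active = refl

active-⊕ʳ : ∀ A B → active B ≡ true → active (A ⊕ B) ≡ true
active-⊕ʳ A B B-active rewrite active-⊕ A B | B-active = ∨-zeroʳ (active A)

active-⊕-inactiveʳ : ∀ A B → active B ≡ false → active (A ⊕ B) ≡ active A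
active-⊕-inactiveʳ A B B-inactive rewrite active-⊕ A B | B-inactive = ∨-identityʳ (active A)

active-⊕-congˡ : ∀ A B C → active A ≡ active B → active (A ⊕ C) ≡ active (B ⊕ C)
active-⊕-congˡ A B C eq rewrite active-⊕ A C | active-⊕ B C | eq = refl

inactive-⊕-𝒫 : ∀ A B → active A ≡ false → active B ≡ false → outcome (A ⊕ B) ≡ 𝒫
inactive-⊕-𝒫 A B A-inactive B-inactive =
  inactive⇒𝒫 (A ⊕ B) (trans (active-⊕-inactiveʳ A B B-inactive) A-inactive)

addL≡map : ∀ Gs H → addL Gs H ≡ map (_⊕ H) Gs
addL≡map []       H = refl
addL≡map (G ∷ Gs) H = cong (G ⊕ H ∷_) (addL≡map Gs H)

addR≡map : ∀ G Hs → addR G Hs ≡ map (G ⊕_) Hs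
addR≡map G []       = refl
addR≡map G (H ∷ Hs) = cong (G ⊕ H ∷_) (addR≡map G Hs)

∈-⊕ˡ : ∀ A B {A′} → A′ ∈ options A → A′ ⊕ B ∈ options (A ⊕ B)
∈-⊕ˡ (mk As _) (mk Bs b) A′∈ rewrite addL≡map As (mk Bs b) = ∈-++⁺ˡ (∈-map⁺ _ A′∈)

∈-⊕ʳ : ∀ A B {B′} → B′ ∈ options B → A ⊕ B′ ∈ options (A ⊕ B)
∈-⊕ʳ (mk As a) (mk Bs _) B′∈ rewrite addR≡map (mk As a) Bs = ∈-++⁺ʳ _ (∈-map⁺ _ B′∈)

∈-⊕⁻ : ∀ A B {X} → X ∈ options (A ⊕ B) →
       (Σ Game λ A′ → A′ ∈ options A × X ≡ A′ ⊕ B) ⊎ (Σ Game λ B′ → B′ ∈ options B × X ≡ A ⊕ B′)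
∈-⊕⁻ (mk As a) (mk Bs b) X∈ rewrite addL≡map As (mk Bs b) | addR≡map (mk As a) Bs =
  Sum.map (∈-map⁻ _) (∈-map⁻ _) (∈-++⁻ (map _ As) X∈)

⊕-𝒫-intro : ∀ A B →
  (active (A ⊕ B) ≡ true → ∀ A′ → A′ ∈ options A → outcome (A′ ⊕ B) ≡ 𝒩) →
  (active (A ⊕ B) ≡ true → ∀ B′ → B′ ∈ options B → outcome (A ⊕ B′) ≡ 𝒩) →
  outcome (A ⊕ B) ≡ 𝒫
⊕-𝒫-intro A B left𝒩 right𝒩 = 𝒫-intro (A ⊕ B) all𝒩
  where
  all𝒩 : active (A ⊕ B) ≡ true → ∀ X → X ∈ options (A ⊕ B) → outcome X ≡ 𝒩
  all𝒩 act X X∈ with ∈-⊕⁻ A B X∈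
  ... | inj₁ (A′ , A′∈ , refl) = left𝒩 act A′ A′∈
  ... | inj₂ (B′ , B′∈ , refl) = right𝒩 act B′ B′∈

⊕-𝒩-introˡ : ∀ A B {A′} → active (A ⊕ B) ≡ true → A′ ∈ options A →
             outcome (A′ ⊕ B) ≡ 𝒫 → outcome (A ⊕ B) ≡ 𝒩
⊕-𝒩-introˡ A B act A′∈ = 𝒩-intro (A ⊕ B) act (∈-⊕ˡ A B A′∈)

⊕-𝒩-introʳ : ∀ A B {B′} → active (A ⊕ B) ≡ true → B′ ∈ options B →
             outcome (A ⊕ B′) ≡ 𝒫 → outcome (A ⊕ B) ≡ 𝒩
⊕-𝒩-introʳ A B act B′∈ = 𝒩-intro (A ⊕ B) act (∈-⊕ʳ A B B′∈)

-- Mirror games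

mutual
  mirror : Game → Game
  mirror (mk Gs _) = mk (mirrors Gs) true

  mirrors : List Game → List Game
  mirrors []       = []
  mirrors (G ∷ Gs) = mirror G ∷ mirrors Gs

mirrors≡map : ∀ Gs → mirrors Gs ≡ map mirror Gs
mirrors≡map []       = refl
mirrors≡map (G ∷ Gs) = cong (mirror G ∷_) (mirrors≡map Gs)

mirror-active : ∀ G → active (mirror G) ≡ true
mirror-active (mk _ _) = refl

∈-mirror⁺ : ∀ G {G′} → G′ ∈ options G → mirror G′ ∈ options (mirror G)
∈-mirror⁺ (mk Gs _) G′∈ rewrite mirrors≡map Gs = ∈-map⁺ mirror G′∈

∈-mirror⁻ : ∀ G {X} → X ∈ options (mirror G) → Σ Game λ G′ → G′ ∈ options G × X ≡ mirror G′
∈-mirror⁻ (mk Gs _) X∈ rewrite mirrors≡map Gs = ∈-map⁻ mirror X∈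

⊕-mirror-𝒫 : ∀ G → outcome (G ⊕ mirror G) ≡ 𝒫
⊕-mirror-𝒫 = game-ind _ step
  where
  step : ∀ G → (∀ G′ → G′ ∈ options G → outcome (G′ ⊕ mirror G′) ≡ 𝒫) → outcome (G ⊕ mirror G) ≡ 𝒫
  step G ih = ⊕-𝒫-intro G (mirror G)
    (λ _ G′ G′∈ → ⊕-𝒩-introʳ G′ (mirror G) (active-⊕ʳ G′ _ (mirror-active G))
                              (∈-mirror⁺ G G′∈) (ih G′ G′∈))
    (λ _ → replies)
    where
    replies : ∀ X → X ∈ options (mirror G) → outcome (G ⊕ X) ≡ 𝒩
    replies X X∈ with ∈-mirror⁻ G X∈
    ... | G′ , G′∈ , refl =
      ⊕-𝒩-introˡ G (mirror G′) (active-⊕ʳ G _ (mirror-active G′)) G′∈ (ih G′ G′∈)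

mirror-replyˡ : ∀ A′ T → active (A′ ⊕ T) ≡ true → mirror A′ ∈ options T → outcome (A′ ⊕ T) ≡ 𝒩
mirror-replyˡ A′ T act mirror∈ = ⊕-𝒩-introʳ A′ T act mirror∈ (⊕-mirror-𝒫 A′)

mirror-replyʳ : ∀ A X → X ∈ options (mirror A) → outcome (A ⊕ X) ≡ 𝒩
mirror-replyʳ A X X∈ with ∈-mirror⁻ A X∈
... | A′ , A′∈ , refl =
  ⊕-𝒩-introˡ A (mirror A′) (active-⊕ʳ A _ (mirror-active A′)) A′∈ (⊕-mirror-𝒫 A′)

-- Apartness and separating contexts

infix 4 _≉_

record _≉_ (A B : Game) : Set where
  constructor apart-in
  field
    test   : Game
    differ : outcome (A ⊕ test) ≢ outcome (B ⊕ test)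

≈-sym : ∀ {A B} → A ≈ B → B ≈ A
≈-sym A≈B X = sym (A≈B X)

≉-sym : ∀ {A B} → A ≉ B → B ≉ A
≉-sym (apart-in X differ) = apart-in X λ same → differ (sym same)

≉⇒¬≈ : ∀ {A B} → A ≉ B → ¬ A ≈ B
≉⇒¬≈ (apart-in X differ) A≈B = differ (A≈B X)

≈-or-≉-sym : ∀ {A B} → A ≈ B ⊎ A ≉ B → B ≈ A ⊎ B ≉ A
≈-or-≉-sym {A} {B} = Sum.map (≈-sym {A} {B}) ≉-sym

𝒫𝒩⇒≉ : ∀ {A B} X → outcome (A ⊕ X) ≡ 𝒫 → outcome (B ⊕ X) ≡ 𝒩 → A ≉ B
𝒫𝒩⇒≉ X A⊕X-𝒫 B⊕X-𝒩 = apart-in X λ same → 𝒩≢𝒫 (trans (sym B⊕X-𝒩) (trans (sym same) A⊕X-𝒫))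

left-if-≈ : ∀ {A B} {C : Set p} → A ≈ B → C ⊎ A ≉ B → C
left-if-≈ _   (inj₁ c)     = c
left-if-≈ A≈B (inj₂ apart) = ⊥-elim (≉⇒¬≈ apart A≈B)

record Separator (A B : Game) : Set where
  field
    context        : Game
    active-context : active context ≡ true
    left-𝒫         : outcome (A ⊕ context) ≡ 𝒫
    right-𝒩        : outcome (B ⊕ context) ≡ 𝒩

open Separator

𝒩𝒫⇒Separator : ∀ A B D → outcome (A ⊕ D) ≡ 𝒩 → outcome (B ⊕ D) ≡ 𝒫 → Separator A B
𝒩𝒫⇒Separator A B D A⊕D-𝒩 B⊕D-𝒫 = record
  { context        = T
  ; active-context = refl
  ; left-𝒫         = ⊕-𝒫-intro A T
      (λ _ A′ A′∈ → mirror-replyˡ A′ T (active-⊕ʳ A′ T refl) (there (∈-mirror⁺ A A′∈)))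
      (λ _ → replies)
  ; right-𝒩        = ⊕-𝒩-introʳ B T (active-⊕ʳ B T refl) (here refl) B⊕D-𝒫
  }
  where
  T : Game
  T = mk (D ∷ options (mirror A)) true

  replies : ∀ X → X ∈ options T → outcome (A ⊕ X) ≡ 𝒩
  replies X (here refl) = A⊕D-𝒩
  replies X (there X∈)  = mirror-replyʳ A X X∈

≉⇒Separator : ∀ {A B} → A ≉ B → Separator A B
≉⇒Separator {A} {B} (apart-in D differ) with outcome (A ⊕ D) in A⊕D | outcome (B ⊕ D) in B⊕D
... | 𝒩 | 𝒫 = 𝒩𝒫⇒Separator A B D A⊕D B⊕D
... | 𝒫 | 𝒩 = let S = 𝒩𝒫⇒Separator B A D B⊕D A⊕D in
              𝒩𝒫⇒Separator A B (context S) (right-𝒩 S) (left-𝒫 S)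
... | 𝒩 | 𝒩 = ⊥-elim (differ refl)
... | 𝒫 | 𝒫 = ⊥-elim (differ refl)

module _ {A B : Game}
         (sepA : ∀ A′ → A′ ∈ options A → Separator A′ B)
         (sepB : ∀ B′ → B′ ∈ options B → Separator B′ A) where

  𝒫-against-separators : ∀ T → active T ≡ true →
    (∀ A′ (A′∈ : A′ ∈ options A) → context (sepA A′ A′∈) ∈ options T) →
    (∀ X → X ∈ options T →
       (Σ Game λ A′ → Σ (A′ ∈ options A) λ A′∈ → X ≡ context (sepA A′ A′∈)) ⊎
       (Σ Game λ B′ → Σ (B′ ∈ options B) λ B′∈ → X ≡ context (sepB B′ B′∈))) →
    outcome (A ⊕ T) ≡ 𝒫
  𝒫-against-separators T T-active offered origin = ⊕-𝒫-intro A T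
    (λ _ A′ A′∈ → ⊕-𝒩-introʳ A′ T (active-⊕ʳ A′ T T-active) (offered A′ A′∈) (left-𝒫 (sepA A′ A′∈)))
    (λ _ → replies)
    where
    replies : ∀ X → X ∈ options T → outcome (A ⊕ X) ≡ 𝒩
    replies X X∈ with origin X X∈
    ... | inj₁ (A′ , A′∈ , refl) =
      ⊕-𝒩-introˡ A _ (active-⊕ʳ A _ (active-context (sepA A′ A′∈))) A′∈ (left-𝒫 (sepA A′ A′∈))
    ... | inj₂ (B′ , B′∈ , refl) = right-𝒩 (sepB B′ B′∈)

common-𝒫-context : ∀ {A B} →
  (∀ A′ → A′ ∈ options A → Separator A′ B) → (∀ B′ → B′ ∈ options B → Separator B′ A) →
  Σ Game λ T → active T ≡ true × outcome (A ⊕ T) ≡ 𝒫 × outcome (B ⊕ T) ≡ 𝒫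
common-𝒫-context {A} {B} sepA sepB =
  T , refl ,
  𝒫-against-separators sepA sepB T refl
    (λ _ A′∈ → ∈-++⁺ˡ (∈-mapWith∈⁺ ctxA A′∈)) origin ,
  𝒫-against-separators sepB sepA T refl
    (λ _ B′∈ → ∈-++⁺ʳ (mapWith∈ (options A) ctxA) (∈-mapWith∈⁺ ctxB B′∈))
    (λ X X∈ → Sum.swap (origin X X∈))
  where
  ctxA : ∀ {A′} → A′ ∈ options A → Game
  ctxA A′∈ = context (sepA _ A′∈)

  ctxB : ∀ {B′} → B′ ∈ options B → Game
  ctxB B′∈ = context (sepB _ B′∈)

  T : Game
  T = mk (mapWith∈ (options A) ctxA ++ mapWith∈ (options B) ctxB) true

  origin : ∀ X → X ∈ options T →
    (Σ Game λ A′ → Σ (A′ ∈ options A) λ A′∈ → X ≡ ctxA A′∈) ⊎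
    (Σ Game λ B′ → Σ (B′ ∈ options B) λ B′∈ → X ≡ ctxB B′∈)
  origin X X∈ = Sum.map (∈-mapWith∈⁻ _ ctxA) (∈-mapWith∈⁻ _ ctxB)
                        (∈-++⁻ (mapWith∈ (options A) ctxA) X∈)

unmatched⇒≉ : ∀ {A B B′} → B′ ∈ options B →
  (∀ A′ → A′ ∈ options A → Separator A′ B′) → (∀ B″ → B″ ∈ options B′ → Separator B″ A) →
  A ≉ B
unmatched⇒≉ {B = B} B′∈ sepA sepB′ with common-𝒫-context sepA sepB′
... | T , T-active , A⊕T-𝒫 , B′⊕T-𝒫 =
  𝒫𝒩⇒≉ T A⊕T-𝒫 (⊕-𝒩-introˡ B T (active-⊕ʳ B T T-active) B′∈ B′⊕T-𝒫)

AllActive : Game → Set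
AllActive G = ∀ G′ → G′ ∈ options G → active G′ ≡ true

SomeInactive : Game → Set
SomeInactive G = Σ Game λ G′ → G′ ∈ options G × active G′ ≡ false

someInactive-true : ∀ Gs → someInactive Gs ≡ true → SomeInactive (mk Gs true)
someInactive-true (G ∷ Gs) e with active G in G-active
... | false = G , here refl , G-active
... | true with someInactive-true Gs e
...   | G′ , G′∈ , G′-inactive = G′ , there G′∈ , G′-inactive

someInactive-false : ∀ Gs → someInactive Gs ≡ false → AllActive (mk Gs true)
someInactive-false (G ∷ Gs) e G′ G′∈ with active G in G-active
someInactive-false (G ∷ Gs) e G′ (here refl) | true = G-active
someInactive-false (G ∷ Gs) e G′ (there G′∈) | true = someInactive-false Gs e G′ G′∈
someInactive-false (G ∷ Gs) () G′ G′∈ | false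

data TypeView (G : Game) : GType → Set where
  inactive      : active G ≡ false → TypeView G t0
  some-inactive : active G ≡ true → SomeInactive G → TypeView G t1∃0
  all-active    : active G ≡ true → AllActive G → TypeView G t1∀1

typeView : ∀ G → TypeView G (type G)
typeView (mk Gs false) = inactive refl
typeView (mk Gs true) with someInactive Gs in e
... | true  = some-inactive refl (someInactive-true Gs e)
... | false = all-active refl (someInactive-false Gs e)

-- An active B is 𝒩 next to 0 = {}⁰ or, failing that, next to {0}⁰.
𝒩-inactive-context : ∀ B → active B ≡ true → Σ Game λ X → active X ≡ false × outcome (B ⊕ X) ≡ 𝒩
𝒩-inactive-context B B-active with outcome (B ⊕ mk [] false) in B⊕0
... | 𝒩 = mk [] false , refl , B⊕0
... | 𝒫 = mk (mk [] false ∷ []) false , refl ,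
          ⊕-𝒩-introʳ B _ (active-⊕ˡ B _ B-active) (here refl) B⊕0

inactive≉active : ∀ {A B} → active A ≡ false → active B ≡ true → A ≉ B
inactive≉active {A} {B} A-inactive B-active with 𝒩-inactive-context B B-active
... | X , X-inactive , B⊕X-𝒩 =
  𝒫𝒩⇒≉ X (inactive-⊕-𝒫 A X A-inactive X-inactive) B⊕X-𝒩

-- B ⊕ D is 𝒫 by mirroring, which needs the options of B to be active as D is
-- not; A ⊕ D is 𝒩 by the move to the inactive, hence 𝒫, position A₀ ⊕ D.
some-inactive≉all-active : ∀ {A B} → active A ≡ true → SomeInactive A → AllActive B → A ≉ B
some-inactive≉all-active {A} {B} A-active (A₀ , A₀∈ , A₀-inactive) B-all-active =
  ≉-sym (𝒫𝒩⇒≉ D B⊕D-𝒫 A⊕D-𝒩)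
  where
  D : Game
  D = mk (options (mirror B)) false

  A⊕D-𝒩 : outcome (A ⊕ D) ≡ 𝒩
  A⊕D-𝒩 = ⊕-𝒩-introˡ A D (active-⊕ˡ A D A-active) A₀∈ (inactive-⊕-𝒫 A₀ D A₀-inactive refl)

  B⊕D-𝒫 : outcome (B ⊕ D) ≡ 𝒫
  B⊕D-𝒫 = ⊕-𝒫-intro B D
    (λ _ B′ B′∈ → mirror-replyˡ B′ D (active-⊕ˡ B′ D (B-all-active B′ B′∈)) (∈-mirror⁺ B B′∈))
    (λ _ → mirror-replyʳ B)

type-≡-or-≉ : ∀ A B → type A ≡ type B ⊎ A ≉ B
type-≡-or-≉ A B = compare (typeView A) (typeView B)
  where
  compare : ∀ {s t} → TypeView A s → TypeView B t → s ≡ t ⊎ A ≉ B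
  compare (inactive _)        (inactive _)        = inj₁ refl
  compare (some-inactive _ _) (some-inactive _ _) = inj₁ refl
  compare (all-active _ _)    (all-active _ _)    = inj₁ refl
  compare (inactive a)        (some-inactive b _) = inj₂ (inactive≉active a b)
  compare (inactive a)        (all-active b _)    = inj₂ (inactive≉active a b)
  compare (some-inactive a _) (inactive b)        = inj₂ (≉-sym (inactive≉active b a))
  compare (all-active a _)    (inactive b)        = inj₂ (≉-sym (inactive≉active b a))
  compare (some-inactive a i) (all-active _ all)  = inj₂ (some-inactive≉all-active a i all)
  compare (all-active _ all)  (some-inactive b i) = inj₂ (≉-sym (some-inactive≉all-active b i all))

same-type⇒active-≡ : ∀ {A B t} → TypeView A t → TypeView B t → active A ≡ active B
same-type⇒active-≡ (inactive a)        (inactive b)        = trans a (sym b)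
same-type⇒active-≡ (some-inactive a _) (some-inactive b _) = trans a (sym b)
same-type⇒active-≡ (all-active a _)    (all-active b _)    = trans a (sym b)

same-type⇒AllActive : ∀ {A B t} → TypeView A t → TypeView B t →
                      active A ≡ true → AllActive A → AllActive B
same-type⇒AllActive (inactive A-inactive) _ A-active _ =
  ⊥-elim (true≢false (trans (sym A-active) A-inactive))
same-type⇒AllActive (some-inactive _ (A₀ , A₀∈ , A₀-inactive)) _ _ A-all-active =
  ⊥-elim (true≢false (trans (sym (A-all-active A₀ A₀∈)) A₀-inactive))
same-type⇒AllActive (all-active _ _) (all-active _ B-all-active) _ _ = B-all-active

Matched : Game → Game → Set
Matched A′ B = (Σ Game λ B′ → B′ ∈ options B × A′ ≈ B′) ⊎ (Σ Game λ A″ → A″ ∈ options A′ × A″ ≈ B)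

OptionsMatched : Game → Game → Set
OptionsMatched A B = ∀ A′ → A′ ∈ options A → Matched A′ B

module _ {A B : Game} {t : GType} (viewA : TypeView A t) (viewB : TypeView B t)
         (B-matched : OptionsMatched B A) where

  𝒫-transfer : ∀ X → (∀ X′ → X′ ∈ options X → outcome (A ⊕ X′) ≡ outcome (B ⊕ X′)) →
               outcome (A ⊕ X) ≡ 𝒫 → outcome (B ⊕ X) ≡ 𝒫
  𝒫-transfer X ih A⊕X-𝒫 = ⊕-𝒫-intro B X B-moves X-moves
    where
    A⊕X-active : active (B ⊕ X) ≡ true → active (A ⊕ X) ≡ true
    A⊕X-active act = trans (active-⊕-congˡ A B X (same-type⇒active-≡ viewA viewB)) act

    X-moves : active (B ⊕ X) ≡ true → ∀ X′ → X′ ∈ options X → outcome (B ⊕ X′) ≡ 𝒩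
    X-moves act X′ X′∈ =
      trans (sym (ih X′ X′∈)) (𝒫-elim (A ⊕ X) A⊕X-𝒫 (A⊕X-active act) (∈-⊕ʳ A X X′∈))

    -- With X inactive, A ⊕ X can only be active through A, and then every
    -- A′ ⊕ X is 𝒩, so A and (by the type) B have only active options.
    B′⊕X-active : active (B ⊕ X) ≡ true → ∀ B′ → B′ ∈ options B → active (B′ ⊕ X) ≡ true
    B′⊕X-active act B′ B′∈ with active X in X-active
    ... | true  = active-⊕ʳ B′ X X-active
    ... | false = active-⊕ˡ B′ X (same-type⇒AllActive viewA viewB A-active A-all-active B′ B′∈)
      where
      A-active : active A ≡ true
      A-active = trans (sym (active-⊕-inactiveʳ A X X-active)) (A⊕X-active act)

      A-all-active : AllActive A
      A-all-active A′ A′∈ =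
        trans (sym (active-⊕-inactiveʳ A′ X X-active))
              (𝒩⇒active (A′ ⊕ X) (𝒫-elim (A ⊕ X) A⊕X-𝒫 (A⊕X-active act) (∈-⊕ˡ A X A′∈)))

    B-moves : active (B ⊕ X) ≡ true → ∀ B′ → B′ ∈ options B → outcome (B′ ⊕ X) ≡ 𝒩
    B-moves act B′ B′∈ with B-matched B′ B′∈
    ... | inj₁ (A′ , A′∈ , B′≈A′) =
      trans (B′≈A′ X) (𝒫-elim (A ⊕ X) A⊕X-𝒫 (A⊕X-active act) (∈-⊕ˡ A X A′∈))
    ... | inj₂ (B″ , B″∈ , B″≈A) =
      ⊕-𝒩-introˡ B′ X (B′⊕X-active act B′ B′∈) B″∈ (trans (B″≈A X) A⊕X-𝒫)

≈-intro : ∀ A B → type A ≡ type B → OptionsMatched A B → OptionsMatched B A → A ≈ B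
≈-intro A B same-type A-matched B-matched =
  game-ind _ λ X ih → ≡-by-𝒫 (𝒫-transfer viewA viewB B-matched X ih)
                              (𝒫-transfer viewB viewA A-matched X (λ X′ X′∈ → sym (ih X′ X′∈)))
  where
  viewA : TypeView A (type B)
  viewA = subst (TypeView A) same-type (typeView A)

  viewB : TypeView B (type B)
  viewB = typeView B

matched-or-≉ : ∀ {A B A′} → A′ ∈ options A →
  (∀ B′ → B′ ∈ options B → A′ ≈ B′ ⊎ A′ ≉ B′) →
  (∀ A″ → A″ ∈ options A′ → A″ ≈ B ⊎ A″ ≉ B) →
  Matched A′ B ⊎ B ≉ A
matched-or-≉ {B = B} {A′} A′∈ compare-options compare-reversals
  with ∈-any-or-all (options B) compare-options | ∈-any-or-all (options A′) compare-reversals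
... | inj₁ equal | _          = inj₁ (inj₁ equal)
... | inj₂ _     | inj₁ equal = inj₁ (inj₂ equal)
... | inj₂ apart | inj₂ apart′ = inj₂ (unmatched⇒≉ A′∈
  (λ B′ B′∈ → ≉⇒Separator (≉-sym (apart B′ B′∈)))
  (λ A″ A″∈ → ≉⇒Separator (apart′ A″ A″∈)))

options-matched-or-≉ : ∀ {A B} → (∀ A′ → A′ ∈ options A → Matched A′ B ⊎ B ≉ A) →
                       OptionsMatched A B ⊎ B ≉ A
options-matched-or-≉ {A} each with ∈-any-or-all (options A) (λ A′ A′∈ → Sum.swap (each A′ A′∈))
... | inj₁ (_ , _ , apart) = inj₂ apart
... | inj₂ matched         = inj₁ matched

-- Deciding equality

≈-intro-or-≉ : ∀ {A B} → type A ≡ type B ⊎ A ≉ B →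
  OptionsMatched A B ⊎ B ≉ A → OptionsMatched B A ⊎ A ≉ B → A ≈ B ⊎ A ≉ B
≈-intro-or-≉ (inj₂ apart) _ _                                = inj₂ apart
≈-intro-or-≉ (inj₁ _) (inj₂ apart) _                         = inj₂ (≉-sym apart)
≈-intro-or-≉ (inj₁ _) (inj₁ _) (inj₂ apart)                  = inj₂ apart
≈-intro-or-≉ {A} {B} (inj₁ same-type) (inj₁ A-matched) (inj₁ B-matched) =
  inj₁ (≈-intro A B same-type A-matched B-matched)

≈-or-≉-bounded : ∀ n A B → height A + height B < n → A ≈ B ⊎ A ≉ B
≈-or-≉-bounded (suc n) A B (s≤s bound) = ≈-intro-or-≉ (type-≡-or-≉ A B)
  (options-matched-or-≉ λ A′ A′∈ → matched-or-≉ A′∈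
    (λ B′ B′∈ → recurse (+-mono-< (height-option< A A′∈) (height-option< B B′∈)))
    (λ A″ A″∈ → recurse (+-monoˡ-< (height B) (grandoption< A A′∈ A″∈))))
  (options-matched-or-≉ λ B′ B′∈ → matched-or-≉ B′∈
    (λ A′ A′∈ → ≈-or-≉-sym (recurse (+-mono-< (height-option< A A′∈) (height-option< B B′∈))))
    (λ B″ B″∈ → ≈-or-≉-sym (recurse (+-monoʳ-< (height A) (grandoption< B B′∈ B″∈)))))
  where
  recurse : ∀ {A₀ B₀} → height A₀ + height B₀ < height A + height B → A₀ ≈ B₀ ⊎ A₀ ≉ B₀
  recurse smaller = ≈-or-≉-bounded n _ _ (<-≤-trans smaller bound)

  grandoption< : ∀ G {G′ G″} → G′ ∈ options G → G″ ∈ options G′ → height G″ < height G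
  grandoption< G {G′} G′∈ G″∈ = <-trans (height-option< G′ G″∈) (height-option< G G′∈)

≈-or-≉ : ∀ A B → A ≈ B ⊎ A ≉ B
≈-or-≉ A B = ≈-or-≉-bounded (suc (height A + height B)) A B ≤-refl

≈⇒type-≡ : ∀ A B → A ≈ B → type A ≡ type B
≈⇒type-≡ A B A≈B = left-if-≈ A≈B (type-≡-or-≉ A B)

≈⇒OptionsMatched : ∀ A B → A ≈ B → OptionsMatched A B
≈⇒OptionsMatched A B A≈B A′ A′∈ =
  left-if-≈ (≈-sym {A} {B} A≈B)
            (matched-or-≉ {A} {B} A′∈ (λ B′ _ → ≈-or-≉ A′ B′) (λ A″ _ → ≈-or-≉ A″ B))

equal-option-or-uncovered : ∀ G′ H → (Σ Game λ H′ → H′ ∈ options H × G′ ≈ H′) ⊎ UncoveredBy G′ H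
equal-option-or-uncovered G′ H =
  Sum.map₂ (λ apart H′ H′∈ → ≉⇒¬≈ (apart H′ H′∈))
           (∈-any-or-all (options H) (λ H′ _ → ≈-or-≉ G′ H′))

theorem3p34 : (G H : Game) → CoveredBy G H →
    (G ≈ H ⇔ (type G ≡ type H
              × (∀ H′ → H′ ∈ options H → UncoveredBy H′ G →
                   Σ Game λ H″ → H″ ∈ options H′ × H″ ≈ G)))
theorem3p34 G H covered = mk⇔ to from
  where
  to : G ≈ H → type G ≡ type H × (∀ H′ → H′ ∈ options H → UncoveredBy H′ G →
                                    Σ Game λ H″ → H″ ∈ options H′ × H″ ≈ G)
  to G≈H = ≈⇒type-≡ G H G≈H , reversible
    where
    reversible : ∀ H′ → H′ ∈ options H → UncoveredBy H′ G → Σ Game λ H″ → H″ ∈ options H′ × H″ ≈ G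
    reversible H′ H′∈ uncovered with ≈⇒OptionsMatched H G (≈-sym {G} {H} G≈H) H′ H′∈
    ... | inj₁ (G′ , G′∈ , H′≈G′) = ⊥-elim (uncovered G′ G′∈ H′≈G′)
    ... | inj₂ reversal           = reversal

  from : type G ≡ type H × (∀ H′ → H′ ∈ options H → UncoveredBy H′ G →
                              Σ Game λ H″ → H″ ∈ options H′ × H″ ≈ G) → G ≈ H
  from (same-type , reversible) = ≈-intro G H same-type G-matched H-matched
    where
    G-matched : OptionsMatched G H
    G-matched G′ G′∈ with equal-option-or-uncovered G′ H
    ... | inj₁ equal     = inj₁ equal
    ... | inj₂ uncovered = ⊥-elim (covered (G′ , G′∈ , uncovered))

    H-matched : OptionsMatched H G
    H-matched H′ H′∈ with equal-option-or-uncovered H′ G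
    ... | inj₁ equal     = inj₁ equal
    ... | inj₂ uncovered = inj₂ (reversible H′ H′∈ uncovered)
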